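{- Let $f:\{0,1\}^*\to\{0,1\}^*$ be the morphism $f(0)=00011$, $f(1)=01100$. Let $\mathbf{w}$ be an infinite binary word, and suppose $f(\mathbf{w})$ has a prefix of the form $0001uv$, where $u$ and $v$ are nonempty Abelian equivalent words. Then $\mathbf{w}$ has a prefix of the form $0x0y0$ for some words $x,y$ with $|x|=|y|$.
   Context: Two binary words are Abelian equivalent if they contain the same number of $0$s and the same number of $1$s. -}

module Defs where

open import Data.Nat using (ℕ; zero; suc; _/_; _%_)
open import Data.Nat.DivMod using (m%n<n)
open import Data.Fin using (Fin; fromℕ<)
open import Data.List using (List; []; _∷_; length)
open import Data.Vec using (Vec; lookup) renaming ([] to []ᵥ; _∷_ to _∷ᵥ_)
open import Relation.Binary.PropositionalEquality using (_≡_; _≢_)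
open import Data.Product using (_×_)

data Bit : Set where
  𝟎 𝟏 : Bit

Word : Set
Word = List Bit

InfWord : Set
InfWord = ℕ → Bit

count : Bit → Word → ℕ
count b [] = 0
count 𝟎 (𝟎 ∷ w) = suc (count 𝟎 w)
count 𝟎 (𝟏 ∷ w) = count 𝟎 w
count 𝟏 (𝟎 ∷ w) = count 𝟏 w
count 𝟏 (𝟏 ∷ w) = suc (count 𝟏 w)

AbelianEquiv : Word → Word → Set
AbelianEquiv u v = (count 𝟎 u ≡ count 𝟎 v) × (count 𝟏 u ≡ count 𝟏 v)

NonEmpty : Word → Set
NonEmpty u = u ≢ []

take : ℕ → InfWord → Word
take zero    w = []
take (suc n) w = w 0 ∷ take n (λ i → w (suc i))

IsPrefixOf : Word → InfWord → Set
IsPrefixOf p w = take (length p) w ≡ p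

f : Bit → Vec Bit 5
f 𝟎 = 𝟎 ∷ᵥ 𝟎 ∷ᵥ 𝟎 ∷ᵥ 𝟏 ∷ᵥ 𝟏 ∷ᵥ []ᵥ
f 𝟏 = 𝟎 ∷ᵥ 𝟏 ∷ᵥ 𝟏 ∷ᵥ 𝟎 ∷ᵥ 𝟎 ∷ᵥ []ᵥ

fω : InfWord → InfWord
fω w n = lookup (f (w (n / 5))) (fromℕ< (m%n<n n 5))

module Submission where

-- Write W = f(w) and let ones(m) be the number of 1s in
-- the prefix of length m of W.  If W = 0001uv with u, v Abelian equivalent
-- of length n, then u and v contain equally many 1s and ones(4) = 1, so
--     ones(4 + 2n) + 1 = ones(4 + n) + ones(4 + n).                     (★)
-- Since f is 5-uniform and both f(0) and f(1) contain two 1s,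
--     ones(5q + r) = 2q + (number of 1s among the first r letters of f(w_q)).
-- Writing n = 5k + r with r < 5, equation (★) loses its dependence on k and
-- becomes an equation between small numbers involving only r and two
-- letters of w; checking all cases leaves r = 0 and w_k = w_{2k} = 0.
-- As u is nonempty, k ≥ 1, and w_0 = 0 because f(1) starts with 01.  The
-- three 0s at positions 0, k and 2k give the prefix 0x0y0, |x| = |y| = k - 1.

open import Defs
open import Data.List using ([]; _∷_; _++_; length)
import Data.List as List
open import Data.List.Properties using (∷-injective)
open import Data.Vec using (lookup; toList)
open import Data.Product using (_×_; ∃-syntax; _,_; proj₁; proj₂)
open import Data.Empty using (⊥-elim)
open import Relation.Binary.PropositionalEquality
  using (_≡_; refl; sym; trans; cong; cong₂; subst; module ≡-Reasoning)
open import Data.Nat using (ℕ; zero; suc; _+_; _*_; _/_; _%_; _<_; _≤_; s≤s)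
open import Data.Nat.Properties using (+-suc; +-comm; +-identityʳ; +-cancelˡ-≡; ≤-refl; <⇒≤; m≤m+n)
open import Data.Nat.DivMod using (m%n<n; m≡m%n+[m/n]*n; [m+n]%n≡m%n; m/n≡1+[m∸n]/n)
open import Data.Nat.Tactic.RingSolver using (solve-∀)
open import Data.Fin.Properties using (fromℕ<-cong)
open ≡-Reasoning

shift : ℕ → InfWord → InfWord
shift a W i = W (a + i)

take-ext : ∀ m {W W′ : InfWord} → (∀ i → W i ≡ W′ i) → take m W ≡ take m W′
take-ext zero    eq = refl
take-ext (suc m) eq = cong₂ _∷_ (eq 0) (take-ext m (λ i → eq (suc i)))

length-take : ∀ m W → length (take m W) ≡ m
length-take zero    W = refl
length-take (suc m) W = cong suc (length-take m (shift 1 W))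

take-+ : ∀ a b W → take (a + b) W ≡ take a W ++ take b (shift a W)
take-+ zero    b W = refl
take-+ (suc a) b W = cong (W 0 ∷_) (take-+ a b (shift 1 W))

take-take : ∀ r L W → r ≤ L → take r W ≡ List.take r (take L W)
take-take zero    L       W _         = refl
take-take (suc r) (suc L) W (s≤s r≤L) = cong (W 0 ∷_) (take-take r L (shift 1 W) r≤L)

take-is-prefix : ∀ m W → IsPrefixOf (take m W) W
take-is-prefix m W rewrite length-take m W = refl

prefix-++⁻ : ∀ p q W → IsPrefixOf (p ++ q) W →
  IsPrefixOf p W × IsPrefixOf q (shift (length p) W)
prefix-++⁻ []      q W q-prefix = refl , q-prefix
prefix-++⁻ (a ∷ p) q W pq-prefix =
  let (W₀≡a , rest) = ∷-injective pq-prefix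
      (p-prefix , q-prefix) = prefix-++⁻ p q (shift 1 W) rest
  in cong₂ _∷_ W₀≡a p-prefix , q-prefix

prefix-++⁺ : ∀ p q W → IsPrefixOf p W → IsPrefixOf q (shift (length p) W) →
  IsPrefixOf (p ++ q) W
prefix-++⁺ []      q W _        q-prefix = q-prefix
prefix-++⁺ (a ∷ p) q W p-prefix q-prefix =
  let (W₀≡a , rest) = ∷-injective p-prefix
  in cong₂ _∷_ W₀≡a (prefix-++⁺ p q (shift 1 W) rest q-prefix)

after-take : ∀ m W q → IsPrefixOf q (shift m W) → IsPrefixOf (take m W ++ q) W
after-take m W q q-prefix =
  prefix-++⁺ (take m W) q W (take-is-prefix m W)
    (subst (λ a → IsPrefixOf q (shift a W)) (sym (length-take m W)) q-prefix)

prefix-∷ : ∀ a b q W → W a ≡ b → IsPrefixOf q (shift (suc a) W) →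
  IsPrefixOf (b ∷ q) (shift a W)
prefix-∷ a b q W Wa≡b q-prefix =
  cong₂ _∷_ (trans (cong W (+-identityʳ a)) Wa≡b)
            (trans (take-ext (length q) (λ i → cong W (+-suc a i))) q-prefix)

three-zeros : ∀ w d → w 0 ≡ 𝟎 → w (suc d) ≡ 𝟎 → w (suc d + suc d) ≡ 𝟎 →
  ∃[ x ] ∃[ y ] (length x ≡ length y × IsPrefixOf (𝟎 ∷ x ++ 𝟎 ∷ y ++ 𝟎 ∷ []) w)
three-zeros w d w₀≡𝟎 w₁≡𝟎 w₂≡𝟎 =
  x , y , trans (length-take d _) (sym (length-take d _)) ,
  prefix-∷ 0 𝟎 _ w w₀≡𝟎
    (after-take d (shift 1 w) _
      (prefix-∷ (suc d) 𝟎 _ w w₁≡𝟎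
        (after-take d (shift (2 + d) w) _
          (prefix-∷ d 𝟎 [] (shift (2 + d) w) w₂≡𝟎′ refl))))
  where
  x y : Word
  x = take d (shift 1 w)
  y = take d (shift (2 + d) w)
  w₂≡𝟎′ : w (2 + d + d) ≡ 𝟎
  w₂≡𝟎′ = trans (cong (λ i → w (suc i)) (sym (+-suc d d))) w₂≡𝟎

ones : InfWord → ℕ → ℕ
ones W m = count 𝟏 (take m W)

count-++ : ∀ b p q → count b (p ++ q) ≡ count b p + count b q
count-++ b [] q = refl
count-++ 𝟎 (𝟎 ∷ p) q = cong suc (count-++ 𝟎 p q)
count-++ 𝟎 (𝟏 ∷ p) q = count-++ 𝟎 p q
count-++ 𝟏 (𝟎 ∷ p) q = count-++ 𝟏 p q
count-++ 𝟏 (𝟏 ∷ p) q = cong suc (count-++ 𝟏 p q)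

length-count : ∀ u → length u ≡ count 𝟎 u + count 𝟏 u
length-count []      = refl
length-count (𝟎 ∷ u) = cong suc (length-count u)
length-count (𝟏 ∷ u) = trans (cong suc (length-count u)) (sym (+-suc (count 𝟎 u) (count 𝟏 u)))

abelian-length : ∀ u v → AbelianEquiv u v → length u ≡ length v
abelian-length u v (same0 , same1) = begin
  length u              ≡⟨ length-count u ⟩
  count 𝟎 u + count 𝟏 u ≡⟨ cong₂ _+_ same0 same1 ⟩
  count 𝟎 v + count 𝟏 v ≡⟨ sym (length-count v) ⟩
  length v              ∎

ones-ext : ∀ m {W W′ : InfWord} → (∀ i → W i ≡ W′ i) → ones W m ≡ ones W′ m
ones-ext m eq = cong (count 𝟏) (take-ext m eq)

ones-+ : ∀ a b W → ones W (a + b) ≡ ones W a + ones (shift a W) b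
ones-+ a b W = trans (cong (count 𝟏) (take-+ a b W)) (count-++ 𝟏 (take a W) _)

square-doubles : ∀ u v W → AbelianEquiv u v → IsPrefixOf (u ++ v) W →
  ones W (length u + length u) ≡ ones W (length u) + ones W (length u)
square-doubles u v W u~v uv-prefix = begin
  ones W (n + n)                 ≡⟨ ones-+ n n W ⟩
  ones W n + ones (shift n W) n  ≡⟨ cong (ones W n +_) second-half ⟩
  ones W n + ones W n            ∎
  where
  n = length u
  halves = prefix-++⁻ u v W uv-prefix
  v-prefix : take n (shift n W) ≡ v
  v-prefix = subst (λ m → take m (shift n W) ≡ v)
                   (sym (abelian-length u v u~v)) (proj₂ halves)
  second-half : ones (shift n W) n ≡ ones W n
  second-half = begin
    ones (shift n W) n ≡⟨ cong (count 𝟏) v-prefix ⟩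
    count 𝟏 v          ≡⟨ sym (proj₂ u~v) ⟩
    count 𝟏 u          ≡⟨ cong (count 𝟏) (sym (proj₁ halves)) ⟩
    ones W n           ∎

Balanced : InfWord → ℕ → Set
Balanced w n = ones (fω w) (4 + (n + n)) + 1 ≡ ones (fω w) (4 + n) + ones (fω w) (4 + n)

balanced-from-square : ∀ w u v → AbelianEquiv u v →
  IsPrefixOf (𝟎 ∷ 𝟎 ∷ 𝟎 ∷ 𝟏 ∷ u ++ v) (fω w) → Balanced w (length u)
balanced-from-square w u v u~v prefix = begin
  ones W (4 + (n + n)) + 1       ≡⟨ cong (_+ 1) (ones-after-header (n + n)) ⟩
  (1 + O (n + n)) + 1            ≡⟨ cong (λ m → (1 + m) + 1) (square-doubles u v _ u~v square) ⟩
  (1 + (O n + O n)) + 1          ≡⟨ regroup (O n) ⟩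
  (1 + O n) + (1 + O n)          ≡⟨ sym (cong₂ _+_ (ones-after-header n) (ones-after-header n)) ⟩
  ones W (4 + n) + ones W (4 + n) ∎
  where
  W = fω w
  O = ones (shift 4 W)
  n = length u
  parts = prefix-++⁻ (𝟎 ∷ 𝟎 ∷ 𝟎 ∷ 𝟏 ∷ []) (u ++ v) W prefix
  square = proj₂ parts
  ones-after-header : ∀ m → ones W (4 + m) ≡ 1 + O m
  ones-after-header m = trans (ones-+ 4 m W) (cong (_+ O m) (cong (count 𝟏) (proj₁ parts)))
  regroup : ∀ c → (1 + (c + c)) + 1 ≡ (1 + c) + (1 + c)
  regroup = solve-∀

prefixOnes : Bit → ℕ → ℕ
prefixOnes b r = count 𝟏 (List.take r (toList (f b)))

prefixOnes-5 : ∀ b → prefixOnes b 5 ≡ 2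
prefixOnes-5 𝟎 = refl
prefixOnes-5 𝟏 = refl

-- If f(w) starts with 00 then w starts with 0, since f(1) starts with 01.
first-letter : ∀ w p → IsPrefixOf (𝟎 ∷ 𝟎 ∷ p) (fω w) → w 0 ≡ 𝟎
first-letter w p prefix with w 0
... | 𝟎 = refl
first-letter w p () | 𝟏

first-block : ∀ w → take 5 (fω w) ≡ toList (f (w 0))
first-block w with w 0
... | 𝟎 = refl
... | 𝟏 = refl

ones-first-block : ∀ w r → r ≤ 5 → ones (fω w) r ≡ prefixOnes (w 0) r
ones-first-block w r r≤5 =
  cong (count 𝟏) (trans (take-take r 5 (fω w) r≤5) (cong (List.take r) (first-block w)))

fω-shift : ∀ w i → fω w (5 + i) ≡ fω (shift 1 w) i
fω-shift w i = cong₂ lookup (cong (λ q → f (w q)) same-block) (fromℕ<-cong _ _ same-offset _ _)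
  where
  same-block : (5 + i) / 5 ≡ 1 + i / 5
  same-block = m/n≡1+[m∸n]/n (m≤m+n 5 i)
  same-offset : (5 + i) % 5 ≡ i % 5
  same-offset = trans (cong (_% 5) (+-comm 5 i)) ([m+n]%n≡m%n i 5)

ones-fω : ∀ w q r → r ≤ 5 → ones (fω w) (5 * q + r) ≡ 2 * q + prefixOnes (w q) r
ones-fω w zero    r r≤5 = ones-first-block w r r≤5
ones-fω w (suc q) r r≤5 = begin
  ones (fω w) (5 * suc q + r)                        ≡⟨ cong (ones (fω w)) (split-block q r) ⟩
  ones (fω w) (5 + (5 * q + r))                      ≡⟨ ones-+ 5 (5 * q + r) (fω w) ⟩
  ones (fω w) 5 + ones (shift 5 (fω w)) (5 * q + r)  ≡⟨ cong₂ _+_ first-two rest ⟩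
  2 + (2 * q + prefixOnes (w (suc q)) r)             ≡⟨ join-block q _ ⟩
  2 * suc q + prefixOnes (w (suc q)) r               ∎
  where
  first-two : ones (fω w) 5 ≡ 2
  first-two = trans (ones-first-block w 5 ≤-refl) (prefixOnes-5 (w 0))
  rest : ones (shift 5 (fω w)) (5 * q + r) ≡ 2 * q + prefixOnes (w (suc q)) r
  rest = trans (ones-ext (5 * q + r) (fω-shift w)) (ones-fω (shift 1 w) q r r≤5)
  split-block : ∀ q r → 5 * suc q + r ≡ 5 + (5 * q + r)
  split-block = solve-∀
  join-block : ∀ q c → 2 + (2 * q + c) ≡ 2 * suc q + c
  join-block = solve-∀

ones-fω-at : ∀ w k a →
  ones (fω w) (5 * k + a) ≡ 2 * (a / 5 + k) + prefixOnes (w (a / 5 + k)) (a % 5)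
ones-fω-at w k a =
  trans (cong (ones (fω w)) position) (ones-fω w (a / 5 + k) (a % 5) (<⇒≤ (m%n<n a 5)))
  where
  regroup : ∀ k q r → 5 * k + (r + q * 5) ≡ 5 * (q + k) + r
  regroup = solve-∀
  position : 5 * k + a ≡ 5 * (a / 5 + k) + a % 5
  position = trans (cong (5 * k +_) (m≡m%n+[m/n]*n a 5)) (regroup k (a / 5) (a % 5))

-- (★) at n = 5k + r after cancelling the 4k ones of complete blocks; b₁ and
-- b₂ are the letters of w whose images contain positions 4 + n and 4 + 2n.
Residual : ℕ → Bit → Bit → Set
Residual r b₁ b₂ =
  2 * (a₂ / 5) + prefixOnes b₂ (a₂ % 5) + 1 ≡
  (2 * (a₁ / 5) + prefixOnes b₁ (a₁ % 5)) + (2 * (a₁ / 5) + prefixOnes b₁ (a₁ % 5))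
  where
  a₁ a₂ : ℕ
  a₁ = 4 + r
  a₂ = 4 + (r + r)

reduced-equation : ∀ w k r → Balanced w (5 * k + r) →
  Residual r (w ((4 + r) / 5 + k)) (w ((4 + (r + r)) / 5 + (k + k)))
reduced-equation w k r balanced = cancel-blocks k c₁ c₂ g₁ g₂ (begin
  2 * (c₂ + (k + k)) + g₂ + 1       ≡⟨ cong (_+ 1) (sym second) ⟩
  ones (fω w) (4 + (n + n)) + 1     ≡⟨ balanced ⟩
  ones (fω w) (4 + n) + ones (fω w) (4 + n) ≡⟨ cong₂ _+_ first first ⟩
  (2 * (c₁ + k) + g₁) + (2 * (c₁ + k) + g₁) ∎)
  where
  n = 5 * k + r
  c₁ = (4 + r) / 5
  c₂ = (4 + (r + r)) / 5
  g₁ = prefixOnes (w (c₁ + k)) ((4 + r) % 5)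
  g₂ = prefixOnes (w (c₂ + (k + k))) ((4 + (r + r)) % 5)
  position₁ : ∀ k r → 4 + (5 * k + r) ≡ 5 * k + (4 + r)
  position₁ = solve-∀
  position₂ : ∀ k r → 4 + ((5 * k + r) + (5 * k + r)) ≡ 5 * (k + k) + (4 + (r + r))
  position₂ = solve-∀
  first : ones (fω w) (4 + n) ≡ 2 * (c₁ + k) + g₁
  first = trans (cong (ones (fω w)) (position₁ k r)) (ones-fω-at w k (4 + r))
  second : ones (fω w) (4 + (n + n)) ≡ 2 * (c₂ + (k + k)) + g₂
  second = trans (cong (ones (fω w)) (position₂ k r)) (ones-fω-at w (k + k) (4 + (r + r)))
  cancel-blocks : ∀ k c₁ c₂ x y →
    2 * (c₂ + (k + k)) + y + 1 ≡ (2 * (c₁ + k) + x) + (2 * (c₁ + k) + x) →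
    2 * c₂ + y + 1 ≡ (2 * c₁ + x) + (2 * c₁ + x)
  cancel-blocks k c₁ c₂ x y eq =
    +-cancelˡ-≡ (4 * k) _ _ (trans (expand₂ k c₂ y) (trans eq (expand₁ k c₁ x)))
    where
    expand₂ : ∀ k c y → 4 * k + (2 * c + y + 1) ≡ 2 * (c + (k + k)) + y + 1
    expand₂ = solve-∀
    expand₁ : ∀ k c x → (2 * (c + k) + x) + (2 * (c + k) + x) ≡ 4 * k + ((2 * c + x) + (2 * c + x))
    expand₁ = solve-∀

residual-solutions : ∀ r b₁ b₂ → r < 5 → Residual r b₁ b₂ → r ≡ 0 × b₁ ≡ 𝟎 × b₂ ≡ 𝟎
residual-solutions 0 𝟎 𝟎 _ _ = refl , refl , refl
residual-solutions 0 𝟎 𝟏 _ ()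
residual-solutions 0 𝟏 𝟎 _ ()
residual-solutions 0 𝟏 𝟏 _ ()
residual-solutions 1 𝟎 𝟎 _ ()
residual-solutions 1 𝟎 𝟏 _ ()
residual-solutions 1 𝟏 𝟎 _ ()
residual-solutions 1 𝟏 𝟏 _ ()
residual-solutions 2 𝟎 𝟎 _ ()
residual-solutions 2 𝟎 𝟏 _ ()
residual-solutions 2 𝟏 𝟎 _ ()
residual-solutions 2 𝟏 𝟏 _ ()
residual-solutions 3 𝟎 𝟎 _ ()
residual-solutions 3 𝟎 𝟏 _ ()
residual-solutions 3 𝟏 𝟎 _ ()
residual-solutions 3 𝟏 𝟏 _ ()
residual-solutions 4 𝟎 𝟎 _ ()
residual-solutions 4 𝟎 𝟏 _ ()
residual-solutions 4 𝟏 𝟎 _ ()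
residual-solutions 4 𝟏 𝟏 _ ()
residual-solutions (suc (suc (suc (suc (suc _))))) _ _ (s≤s (s≤s (s≤s (s≤s (s≤s ()))))) _

forced-residue : ∀ w k r → r < 5 → Balanced w (5 * k + r) →
  r ≡ 0 × w k ≡ 𝟎 × w (k + k) ≡ 𝟎
forced-residue w k r r<5 balanced
  with residual-solutions r _ _ r<5 (reduced-equation w k r balanced)
... | refl , wₖ≡𝟎 , w₂ₖ≡𝟎 = refl , wₖ≡𝟎 , w₂ₖ≡𝟎

forced-positions : ∀ w n → Balanced w n → ∃[ k ] (n ≡ 5 * k × w k ≡ 𝟎 × w (k + k) ≡ 𝟎)
forced-positions w n balanced =
  let (r≡0 , wₖ≡𝟎 , w₂ₖ≡𝟎) = forced-residue w k r (m%n<n n 5) (subst (Balanced w) n≡5k+r balanced)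
  in k , trans n≡5k+r (trans (cong (5 * k +_) r≡0) (+-identityʳ (5 * k))) , wₖ≡𝟎 , w₂ₖ≡𝟎
  where
  k = n / 5
  r = n % 5
  regroup : ∀ k r → r + k * 5 ≡ 5 * k + r
  regroup = solve-∀
  n≡5k+r : n ≡ 5 * k + r
  n≡5k+r = trans (m≡m%n+[m/n]*n n 5) (regroup k r)

mainTheorem11 : (w : InfWord) →
    (∃[ u ] ∃[ v ] (NonEmpty u × NonEmpty v × AbelianEquiv u v ×
        IsPrefixOf (𝟎 ∷ 𝟎 ∷ 𝟎 ∷ 𝟏 ∷ u ++ v) (fω w))) →
    ∃[ x ] ∃[ y ] (length x ≡ length y ×
        IsPrefixOf (𝟎 ∷ x ++ 𝟎 ∷ y ++ 𝟎 ∷ []) w)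
mainTheorem11 w (u , v , u≢[] , _ , u~v , prefix)
  with forced-positions w (length u) (balanced-from-square w u v u~v prefix)
... | zero  , |u|≡0 , _ , _ = ⊥-elim (u≢[] (empty u |u|≡0))
  where
  empty : ∀ (u : Word) → length u ≡ 0 → u ≡ []
  empty [] _ = refl
... | suc d , _ , wₖ≡𝟎 , w₂ₖ≡𝟎 = three-zeros w d (first-letter w _ prefix) wₖ≡𝟎 w₂ₖ≡𝟎
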